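{- For every expression $E$ of the positive calculus of relations over $\Sigma$ and every relational interpretation $\mathcal I=(X,\rho)$, $\langle E\rangle_{\mathcal I}=\llbracket\llbracket E\rrbracket\rrbracket^{T}_{\mathcal I}$.
   Context: Expressions: $E::=R\mid 1\mid E;E\mid\bot\mid E\cup E\mid\top\mid E\cap E\mid E^{op}$, $R\in\Sigma$. A relational interpretation $\mathcal I$ is a set $X$ with $\rho(R)\subseteq X\times X$ for each $R$; $\langle R\rangle=\rho(R)$, $\langle 1\rangle=\{(x,x)\}$, $\langle E_1;E_2\rangle$ relational composition, $\langle\bot\rangle=\emptyset$, $\langle\top\rangle=X\times X$, $\cup,\cap$ set-theoretic, $\langle E^{op}\rangle$ converse. $\Sigma$ is regarded as a monoidal signature with one sort $A$ and every $R$ of type $A\to A$. $\Gamma=\Sigma\cup\{\mathsf c_A:A\to AA,\mathsf d_A:A\to1,\mathsf c^\circ_A:AA\to A,\mathsf d^\circ_A:1\to A\}$, $\mathsf C_\Gamma$ its free strict symmetric monoidal category (string diagrams). Tapes $\mathsf T_\Gamma$: the free strict finite biproduct category on the underlying category of $\mathsf C_\Gamma$, objects polynomials $U_1\oplus\cdots\oplus U_n$ of words over $\{A\}$, arrows terms in $\mathrm{id}$, $\lceil c\rceil$, $\sigma^\oplus$, $\Delta_U:U\to U\oplus U$, $!_U:U\to0$, $\nabla_U:U\oplus U\to U$, $\mathsf i_U:0\to U$, $;$, $\oplus$ modulo fb laws, naturality w.r.t. $\lceil c\rceil$, $\lceil\mathrm{id}\rceil=\mathrm{id}$, $\lceil c;d\rceil=\lceil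 c\rceil;\lceil d\rceil$; with tensor $\otimes$ ($(\bigoplus_iU_i)\otimes(\bigoplus_jV_j)=\bigoplus_i\bigoplus_jU_iV_j$, $t_1\otimes t_2=L_{P_1}(t_2);R_{Q_2}(t_1)$ via whiskerings extending $L_U(\lceil c\rceil)=\lceil\mathrm{id}_U\otimes c\rceil$, $R_U(\lceil c\rceil)=\lceil c\otimes\mathrm{id}_U\rceil$ inductively with left distributors). ($\mathsf T_{\mathsf{CB}_\Sigma}$ is a poset quotient of $\mathsf T_\Gamma$; the semantics below respects it.) Semantics: for a word $A^n$ write $X^n$ for the right-bracketed cartesian power ($X^0=\{\bullet\}$). $\llbracket\cdot\rrbracket^{CB}_{\mathcal I}$ sends $R\mapsto\rho(R)$, $\mathsf c_A\mapsto\{(x,(x,x))\}$, $\mathsf d_A\mapsto\{(x,\bullet)\}$, $\mathsf c^\circ_A,\mathsf d^\circ_A$ to the converses, identities and symmetries to identities and swaps, $;$ to relational composition and $\otimes$ to cartesian product of relations. $\llbracket\cdot\rrbracket^T_{\mathcal I}$ sends $\lceil c\rceil\mapsto\llbracket c\rrbracket^{CB}_{\mathcal I}$, $\oplus$ to disjoint union of relations, $;$ to composition, $\nabla_U\mapsto\{((w,0),w),((w,1),w)\}$, $\mathsf i_U\mapsto\emptyset$, $\Delta_U,!_U$ to their converses, $\sigma^\oplus$ to swaps, and is the unique rig functor with these values (in particular it sends $\otimes$ of tapes to cartesian product of relations). Encoding: $\llbracket R\rrbracket=\lceil R\rceil$, $\llbracket1\rrbracket=\mathrm{id}_A$, $\llbracket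 E_1;E_2\rrbracket=\llbracket E_1\rrbracket;\llbracket E_2\rrbracket$, $\llbracket\bot\rrbracket=!_A;\mathsf i_A$, $\llbracket\top\rrbracket=\lceil\mathsf d_A;\mathsf d^\circ_A\rceil$, $\llbracket E_1\cup E_2\rrbracket=\Delta_A;(\llbracket E_1\rrbracket\oplus\llbracket E_2\rrbracket);\nabla_A$, $\llbracket E_1\cap E_2\rrbracket=\lceil\mathsf c_A\rceil;(\llbracket E_1\rrbracket\otimes\llbracket E_2\rrbracket);\lceil\mathsf c^\circ_A\rceil$, $\llbracket E^{op}\rrbracket=\lceil(\mathsf d^\circ_A;\mathsf c_A)\otimes\mathrm{id}_A\rceil;(\mathrm{id}_A\otimes\llbracket E\rrbracket\otimes\mathrm{id}_A);\lceil\mathrm{id}_A\otimes(\mathsf c^\circ_A;\mathsf d_A)\rceil$. -}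

module Defs where

open import Data.Nat using (ℕ; zero; suc; _+_)
open import Data.List using (List; []; _∷_; _++_; map)
open import Data.List.Properties using (map-++)
open import Data.Vec using (Vec; []; _∷_) renaming (_++_ to _++ᵛ_)
open import Data.Product using (Σ; Σ-syntax; _×_; _,_)
open import Data.Sum using (_⊎_; inj₁; inj₂)
open import Data.Empty using (⊥)
open import Data.Unit using (⊤)
open import Relation.Binary.PropositionalEquality using (_≡_; sym; subst₂)

Rel : Set → Set → Set₁
Rel A B = A → B → Set

infixl 6 _⨾_
infixl 5 _∪_
infixl 5 _∩_

data Expr (Sig : Set) : Set where
  atom : Sig → Expr Sig
  one  : Expr Sig
  _⨾_  : Expr Sig → Expr Sig → Expr Sig
  bot  : Expr Sig
  _∪_  : Expr Sig → Expr Sig → Expr Sig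
  top  : Expr Sig
  _∩_  : Expr Sig → Expr Sig → Expr Sig
  _ᵒᵖ  : Expr Sig → Expr Sig

record RelInterp (Sig : Set) : Set₁ where
  field
    X : Set
    ρ : Sig → Rel X X
open RelInterp public

⟨_⟩ : {Sig : Set} → Expr Sig → (I : RelInterp Sig) → Rel (X I) (X I)
⟨ atom R ⟩ I x y = ρ I R x y
⟨ one ⟩ I x y = x ≡ y
⟨ E₁ ⨾ E₂ ⟩ I x y = Σ[ z ∈ X I ] (⟨ E₁ ⟩ I x z × ⟨ E₂ ⟩ I z y)
⟨ bot ⟩ I x y = ⊥
⟨ E₁ ∪ E₂ ⟩ I x y = ⟨ E₁ ⟩ I x y ⊎ ⟨ E₂ ⟩ I x y
⟨ top ⟩ I x y = ⊤
⟨ E₁ ∩ E₂ ⟩ I x y = ⟨ E₁ ⟩ I x y × ⟨ E₂ ⟩ I x y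
⟨ E ᵒᵖ ⟩ I x y = ⟨ E ⟩ I y x

-- One sort A; a word A^n is represented by n : ℕ,
-- word concatenation is +.  (Raw terms; the semantics below respects the
-- SMC laws, so the theorem is stated on representatives.)

data Diag (Sig : Set) : ℕ → ℕ → Set where
  gen    : Sig → Diag Sig 1 1
  copy   : Diag Sig 1 2
  disc   : Diag Sig 1 0
  cocopy : Diag Sig 2 1
  codisc : Diag Sig 0 1
  idD    : ∀ n → Diag Sig n n
  symD   : ∀ m n → Diag Sig (m + n) (n + m)
  _⨾D_   : ∀ {m n k} → Diag Sig m n → Diag Sig n k → Diag Sig m k
  _⊗D_   : ∀ {m n m' n'} → Diag Sig m n → Diag Sig m' n' → Diag Sig (m + m') (n + n')

-- Tapes T_Γ : objects are polynomials (lists of monomials), strict ⊕ = ++.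

data Tape (Sig : Set) : List ℕ → List ℕ → Set where
  idT  : ∀ P → Tape Sig P P
  ⌈_⌉  : ∀ {U V} → Diag Sig U V → Tape Sig (U ∷ []) (V ∷ [])
  σT   : ∀ U V → Tape Sig (U ∷ V ∷ []) (V ∷ U ∷ [])
  ΔT   : ∀ U → Tape Sig (U ∷ []) (U ∷ U ∷ [])
  !T   : ∀ U → Tape Sig (U ∷ []) []
  ∇T   : ∀ U → Tape Sig (U ∷ U ∷ []) (U ∷ [])
  iT   : ∀ U → Tape Sig [] (U ∷ [])
  _⨾T_ : ∀ {P Q S} → Tape Sig P Q → Tape Sig Q S → Tape Sig P S
  _⊕T_ : ∀ {P Q P' Q'} → Tape Sig P Q → Tape Sig P' Q' → Tape Sig (P ++ P') (Q ++ Q')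

-- Whiskering by a monomial W on the left:  L_W : P → Q  ↦  W⊗P → W⊗Q
-- where W ⊗ (⊕ U_i) = ⊕ (W U_i).
L : ∀ {Sig P Q} (W : ℕ) → Tape Sig P Q → Tape Sig (map (W +_) P) (map (W +_) Q)
L W (idT P) = idT _
L W ⌈ c ⌉ = ⌈ idD W ⊗D c ⌉
L W (σT U V) = σT _ _
L W (ΔT U) = ΔT _
L W (!T U) = !T _
L W (∇T U) = ∇T _
L W (iT U) = iT _
L W (t ⨾T s) = L W t ⨾T L W s
L {Sig} W (_⊕T_ {P} {Q} {P'} {Q'} t s) =
  subst₂ (Tape Sig) (sym (map-++ (W +_) P P')) (sym (map-++ (W +_) Q Q'))
    (L W t ⊕T L W s)

R : ∀ {Sig P Q} (W : ℕ) → Tape Sig P Q → Tape Sig (map (_+ W) P) (map (_+ W) Q)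
R W (idT P) = idT _
R W ⌈ c ⌉ = ⌈ c ⊗D idD W ⌉
R W (σT U V) = σT _ _
R W (ΔT U) = ΔT _
R W (!T U) = !T _
R W (∇T U) = ∇T _
R W (iT U) = iT _
R W (t ⨾T s) = R W t ⨾T R W s
R {Sig} W (_⊕T_ {P} {Q} {P'} {Q'} t s) =
  subst₂ (Tape Sig) (sym (map-++ (_+ W) P P')) (sym (map-++ (_+ W) Q Q'))
    (R W t ⊕T R W s)

-- Tensor of tapes  t₁ ⊗ t₂ = L_{P₁}(t₂) ; R_{Q₂}(t₁), for t₁ : P₁ → Q₁,
-- t₂ : P₂ → Q₂, in the case (the only one used by the encoding) where P₁
-- and Q₂ are monomials, so that no distributors are needed.
_⊗T_ : ∀ {Sig U V Q₁ P₂} → Tape Sig (U ∷ []) Q₁ → Tape Sig P₂ (V ∷ []) →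
       Tape Sig (map (U +_) P₂) (map (_+ V) Q₁)
_⊗T_ {U = U} {V = V} t₁ t₂ = L U t₂ ⨾T R V t₁

A : List ℕ
A = 1 ∷ []

enc : {Sig : Set} → Expr Sig → Tape Sig A A
enc (atom R) = ⌈ gen R ⌉
enc one = idT A
enc (E₁ ⨾ E₂) = enc E₁ ⨾T enc E₂
enc bot = !T 1 ⨾T iT 1
enc (E₁ ∪ E₂) = (ΔT 1 ⨾T (enc E₁ ⊕T enc E₂)) ⨾T ∇T 1
enc top = ⌈ disc ⨾D codisc ⌉
enc (E₁ ∩ E₂) = (⌈ copy ⌉ ⨾T (enc E₁ ⊗T enc E₂)) ⨾T ⌈ cocopy ⌉
enc (E ᵒᵖ) =
  (⌈ (codisc ⨾D copy) ⊗D idD 1 ⌉ ⨾T ((idT A ⊗T enc E) ⊗T idT A))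
    ⨾T ⌈ idD 1 ⊗D (cocopy ⨾D disc) ⌉

-- Semantics.  X^n is represented by Vec X n (canonically isomorphic to the
-- right-bracketed power); a polynomial U₁ ⊕ … ⊕ Uₙ by X^{U₁} ⊎ (… ⊎ ⊥).

module _ {Sig : Set} (I : RelInterp Sig) where

  Pow : ℕ → Set
  Pow n = Vec (X I) n

  ⟦_⟧CB : ∀ {m n} → Diag Sig m n → Rel (Pow m) (Pow n)
  ⟦ gen R ⟧CB (x ∷ []) (y ∷ []) = ρ I R x y
  ⟦ copy ⟧CB (x ∷ []) w = w ≡ x ∷ x ∷ []
  ⟦ disc ⟧CB w w' = ⊤
  ⟦ cocopy ⟧CB w (x ∷ []) = w ≡ x ∷ x ∷ []
  ⟦ codisc ⟧CB w w' = ⊤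
  ⟦ idD n ⟧CB w w' = w ≡ w'
  ⟦ symD m n ⟧CB w w' =
    Σ[ u ∈ Pow m ] Σ[ v ∈ Pow n ] (w ≡ u ++ᵛ v × w' ≡ v ++ᵛ u)
  ⟦ _⨾D_ {n = n} c d ⟧CB w w' = Σ[ z ∈ Pow n ] (⟦ c ⟧CB w z × ⟦ d ⟧CB z w')
  ⟦ _⊗D_ {m} {n} {m'} {n'} c d ⟧CB w w' =
    Σ[ u ∈ Pow m ] Σ[ u' ∈ Pow m' ] Σ[ v ∈ Pow n ] Σ[ v' ∈ Pow n' ]
      (w ≡ u ++ᵛ u' × w' ≡ v ++ᵛ v' × ⟦ c ⟧CB u v × ⟦ d ⟧CB u' v')

  Obj : List ℕ → Set
  Obj [] = ⊥
  Obj (U ∷ P) = Pow U ⊎ Obj P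

  inl : ∀ P Q → Obj P → Obj (P ++ Q)
  inl [] Q ()
  inl (U ∷ P) Q (inj₁ u) = inj₁ u
  inl (U ∷ P) Q (inj₂ p) = inj₂ (inl P Q p)

  inr : ∀ P Q → Obj Q → Obj (P ++ Q)
  inr [] Q q = q
  inr (U ∷ P) Q q = inj₂ (inr P Q q)

  swap⊕ : ∀ U V → Obj (U ∷ V ∷ []) → Obj (V ∷ U ∷ [])
  swap⊕ U V (inj₁ u) = inj₂ (inj₁ u)
  swap⊕ U V (inj₂ (inj₁ v)) = inj₁ v

  codiag : ∀ U → Rel (Obj (U ∷ U ∷ [])) (Obj (U ∷ []))
  codiag U a b = Σ[ w ∈ Pow U ] (b ≡ inj₁ w × (a ≡ inj₁ w ⊎ a ≡ inj₂ (inj₁ w)))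

  ⟦_⟧T : ∀ {P Q} → Tape Sig P Q → Rel (Obj P) (Obj Q)
  ⟦ idT P ⟧T a b = a ≡ b
  ⟦ ⌈_⌉ {U} {V} c ⟧T a b =
    Σ[ u ∈ Pow U ] Σ[ v ∈ Pow V ] (a ≡ inj₁ u × b ≡ inj₁ v × ⟦ c ⟧CB u v)
  ⟦ σT U V ⟧T a b = b ≡ swap⊕ U V a
  ⟦ ΔT U ⟧T a b = codiag U b a
  ⟦ !T U ⟧T a b = ⊥
  ⟦ ∇T U ⟧T a b = codiag U a b
  ⟦ iT U ⟧T a b = ⊥
  ⟦ _⨾T_ {Q = Q} t s ⟧T a b = Σ[ m ∈ Obj Q ] (⟦ t ⟧T a m × ⟦ s ⟧T m b)
  ⟦ _⊕T_ {P} {Q} {P'} {Q'} t s ⟧T a b =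
    (Σ[ p ∈ Obj P ] Σ[ q ∈ Obj Q ] (a ≡ inl P P' p × b ≡ inl Q Q' q × ⟦ t ⟧T p q))
    ⊎ (Σ[ p ∈ Obj P' ] Σ[ q ∈ Obj Q' ] (a ≡ inr P P' p × b ≡ inr Q Q' q × ⟦ s ⟧T p q))

-- The real work is the tensor of tapes t₁ ⊗ t₂ = L_U(t₂) ; R_V(t₁).
-- By induction on tapes, the whiskering L_W (resp. R_W) relates w ++ a exactly to the vectors
-- w ++ b such that t relates a to b; hence the tensor of two tapes between monomials denotes
-- the cartesian product of their relations, which gives intersection, and converse follows
-- from the snake through the cup d° ; c and the cap c° ; d.
module Submission where

open import Defs
open import Data.Nat using (ℕ; _+_)
open import Data.List using (List; []; _∷_; _++_; map)
open import Data.List.Properties using (map-++)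
open import Data.Vec using ([]; _∷_) renaming (_++_ to _++ᵛ_)
open import Data.Vec.Properties using (++-injective)
open import Data.Product using (∃; _×_; _,_)
open import Data.Sum using (_⊎_; inj₁; inj₂; map₂)
open import Data.Sum.Properties using (inj₁-injective; inj₂-injective)
open import Data.Empty using (⊥-elim)
open import Data.Unit using (tt)
open import Relation.Binary.PropositionalEquality using (_≡_; _≢_; refl; sym; trans; cong; subst; subst₂)
open import Relation.Binary.PropositionalEquality.Properties using (subst-injective)
open import Function.Base using (id)
open import Function.Bundles using (_⇔_; mk⇔; Equivalence)
open import Function.Properties.Equivalence using () renaming (sym to ⇔-sym; trans to ⇔-trans)
open import Data.Product.Function.NonDependent.Propositional using (_×-⇔_)
open import Data.Product.Function.Dependent.Propositional using (congˡ)
open import Data.Sum.Function.Propositional using (_⊎-⇔_)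

open Equivalence using (to; from)

Lifts : {A A′ B B′ : Set} → (A → A′) → (B → B′) → Rel A′ B′ → Rel A B → Set
Lifts {B = B} ga gb S T = ∀ a b′ → S (ga a) b′ ⇔ ∃ λ (b : B) → b′ ≡ gb b × T a b

Lifts-≡ : {A A′ : Set} (g : A → A′) → Lifts g g _≡_ _≡_
Lifts-≡ g a b′ = mk⇔ (λ { refl → a , refl , refl }) (λ { (_ , refl , refl) → refl })

module _ {Sig : Set} where

  _∪T_ : ∀ {U} → Tape Sig (U ∷ []) (U ∷ []) → Tape Sig (U ∷ []) (U ∷ []) → Tape Sig (U ∷ []) (U ∷ [])
  _∪T_ {U} t s = (ΔT U ⨾T (t ⊕T s)) ⨾T ∇T U

  _∩T_ : Tape Sig A A → Tape Sig A A → Tape Sig A A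
  t ∩T s = (⌈ copy ⌉ ⨾T (t ⊗T s)) ⨾T ⌈ cocopy ⌉

  cup : Diag Sig 1 3
  cup = (codisc ⨾D copy) ⊗D idD 1

  cap : Diag Sig 3 1
  cap = idD 1 ⊗D (cocopy ⨾D disc)

  _ᵒᵖT : Tape Sig A A → Tape Sig A A
  t ᵒᵖT = (⌈ cup ⌉ ⨾T ((idT A ⊗T t) ⊗T idT A)) ⨾T ⌈ cap ⌉

module _ {Sig : Set} (I : RelInterp Sig) where

  private
    ⟦_⟧ : ∀ {P Q} → Tape Sig P Q → Rel (Obj I P) (Obj I Q)
    ⟦_⟧ = ⟦_⟧T I

    ⟦_⟧ᴰ : ∀ {m n} → Diag Sig m n → Rel (Pow I m) (Pow I n)
    ⟦_⟧ᴰ = ⟦_⟧CB I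

  data Split (P Q : List ℕ) : Obj I (P ++ Q) → Set where
    left  : ∀ p → Split P Q (inl I P Q p)
    right : ∀ q → Split P Q (inr I P Q q)

  split : ∀ P Q o → Split P Q o
  split [] Q o = right o
  split (U ∷ P) Q (inj₁ u) = left (inj₁ u)
  split (U ∷ P) Q (inj₂ o) with split P Q o
  ... | left p = left (inj₂ p)
  ... | right q = right q

  inl-injective : ∀ P Q {p p′} → inl I P Q p ≡ inl I P Q p′ → p ≡ p′
  inl-injective (U ∷ P) Q {inj₁ u} {inj₁ .u} refl = refl
  inl-injective (U ∷ P) Q {inj₂ p} {inj₂ p′} e = cong inj₂ (inl-injective P Q (inj₂-injective e))

  inr-injective : ∀ P Q {q q′} → inr I P Q q ≡ inr I P Q q′ → q ≡ q′
  inr-injective [] Q e = e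
  inr-injective (U ∷ P) Q e = inr-injective P Q (inj₂-injective e)

  inl≢inr : ∀ P Q {p q} → inl I P Q p ≢ inr I P Q q
  inl≢inr (U ∷ P) Q {inj₂ p} e = inl≢inr P Q (inj₂-injective e)

  ⊕T-inl : ∀ {P Q P′ Q′} (t : Tape Sig P Q) (s : Tape Sig P′ Q′) p c →
    ⟦ t ⊕T s ⟧ (inl I P P′ p) c ⇔ ∃ λ q → c ≡ inl I Q Q′ q × ⟦ t ⟧ p q
  ⊕T-inl {P} {Q} {P′} {Q′} t s p c = mk⇔ fwd bwd
    where
    fwd : ⟦ t ⊕T s ⟧ (inl I P P′ p) c → ∃ λ q → c ≡ inl I Q Q′ q × ⟦ t ⟧ p q
    fwd (inj₁ (p′ , q , e , c≡ , h)) = q , c≡ , subst (λ x → ⟦ t ⟧ x q) (sym (inl-injective P P′ e)) h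
    fwd (inj₂ (_ , _ , e , _)) = ⊥-elim (inl≢inr P P′ e)
    bwd : (∃ λ q → c ≡ inl I Q Q′ q × ⟦ t ⟧ p q) → ⟦ t ⊕T s ⟧ (inl I P P′ p) c
    bwd (q , c≡ , h) = inj₁ (p , q , refl , c≡ , h)

  ⊕T-inr : ∀ {P Q P′ Q′} (t : Tape Sig P Q) (s : Tape Sig P′ Q′) p c →
    ⟦ t ⊕T s ⟧ (inr I P P′ p) c ⇔ ∃ λ q → c ≡ inr I Q Q′ q × ⟦ s ⟧ p q
  ⊕T-inr {P} {Q} {P′} {Q′} t s p c = mk⇔ fwd bwd
    where
    fwd : ⟦ t ⊕T s ⟧ (inr I P P′ p) c → ∃ λ q → c ≡ inr I Q Q′ q × ⟦ s ⟧ p q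
    fwd (inj₁ (_ , _ , e , _)) = ⊥-elim (inl≢inr P P′ (sym e))
    fwd (inj₂ (p′ , q , e , c≡ , h)) = q , c≡ , subst (λ x → ⟦ s ⟧ x q) (sym (inr-injective P P′ e)) h
    bwd : (∃ λ q → c ≡ inr I Q Q′ q × ⟦ s ⟧ p q) → ⟦ t ⊕T s ⟧ (inr I P P′ p) c
    bwd (q , c≡ , h) = inj₂ (p , q , refl , c≡ , h)

  ⟦subst₂⟧ : ∀ {P Q P′ Q′} (e₁ : P′ ≡ P) (e₂ : Q′ ≡ Q) (t : Tape Sig P Q) a b →
    ⟦ subst₂ (Tape Sig) (sym e₁) (sym e₂) t ⟧ a b ⇔ ⟦ t ⟧ (subst (Obj I) e₁ a) (subst (Obj I) e₂ b)
  ⟦subst₂⟧ refl refl t a b = mk⇔ id id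

  module Lifting {f : ℕ → ℕ} (g : ∀ {U} → Pow I U → Pow I (f U)) where

    lift : ∀ P → Obj I P → Obj I (map f P)
    lift (U ∷ P) (inj₁ u) = inj₁ (g u)
    lift (U ∷ P) (inj₂ p) = inj₂ (lift P p)

    private
      subst-∷ : ∀ {U P P′} (e : P ≡ P′) (o : Obj I (U ∷ P)) →
        subst (Obj I) (cong (U ∷_) e) o ≡ map₂ (subst (Obj I) e) o
      subst-∷ refl (inj₁ u) = refl
      subst-∷ refl (inj₂ p) = refl

    lift-inl : ∀ P P′ p →
      subst (Obj I) (map-++ f P P′) (lift (P ++ P′) (inl I P P′ p)) ≡ inl I (map f P) (map f P′) (lift P p)
    lift-inl (U ∷ P) P′ (inj₁ u) = subst-∷ (map-++ f P P′) _
    lift-inl (U ∷ P) P′ (inj₂ p) = trans (subst-∷ (map-++ f P P′) _) (cong inj₂ (lift-inl P P′ p))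

    lift-inr : ∀ P P′ p →
      subst (Obj I) (map-++ f P P′) (lift (P ++ P′) (inr I P P′ p)) ≡ inr I (map f P) (map f P′) (lift P′ p)
    lift-inr [] P′ p = refl
    lift-inr (U ∷ P) P′ p = trans (subst-∷ (map-++ f P P′) _) (cong inj₂ (lift-inr P P′ p))

    -- the ⊕ clause of L and R, reindexed along map-++
    _⊕ᶠ_ : ∀ {P Q P′ Q′} → Tape Sig (map f P) (map f Q) → Tape Sig (map f P′) (map f Q′) →
           Tape Sig (map f (P ++ P′)) (map f (Q ++ Q′))
    _⊕ᶠ_ {P} {Q} {P′} {Q′} t′ s′ = subst₂ (Tape Sig) (sym (map-++ f P P′)) (sym (map-++ f Q Q′)) (t′ ⊕T s′)

    ⌈⌉-lifts : ∀ {U V} (c′ : Diag Sig (f U) (f V)) (c : Diag Sig U V) →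
      Lifts g g ⟦ c′ ⟧ᴰ ⟦ c ⟧ᴰ → Lifts (lift (U ∷ [])) (lift (V ∷ [])) ⟦ ⌈ c′ ⌉ ⟧ ⟦ ⌈ c ⌉ ⟧
    ⌈⌉-lifts c′ c c′↑c (inj₁ u) b′ = mk⇔
      (λ { (_ , v′ , refl , refl , h) → let v , e , h′ = to (c′↑c u v′) h in
             inj₁ v , cong inj₁ e , u , v , refl , refl , h′ })
      (λ { (inj₁ v , refl , _ , _ , refl , refl , h) →
             g u , g v , refl , refl , from (c′↑c u (g v)) (v , refl , h) })

    idT-lifts : ∀ P → Lifts (lift P) (lift P) ⟦ idT (map f P) ⟧ ⟦ idT P ⟧
    idT-lifts P = Lifts-≡ (lift P)

    σT-lifts : ∀ U V → Lifts (lift (U ∷ V ∷ [])) (lift (V ∷ U ∷ [])) ⟦ σT (f U) (f V) ⟧ ⟦ σT U V ⟧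
    σT-lifts U V (inj₁ u) b′ =
      mk⇔ (λ { refl → inj₂ (inj₁ u) , refl , refl }) (λ { (_ , refl , refl) → refl })
    σT-lifts U V (inj₂ (inj₁ v)) b′ =
      mk⇔ (λ { refl → inj₁ v , refl , refl }) (λ { (_ , refl , refl) → refl })

    ΔT-lifts : ∀ U → Lifts (lift (U ∷ [])) (lift (U ∷ U ∷ [])) ⟦ ΔT (f U) ⟧ ⟦ ΔT U ⟧
    ΔT-lifts U (inj₁ u) b′ = mk⇔
      (λ { (_ , refl , inj₁ refl) → inj₁ u , refl , u , refl , inj₁ refl
         ; (_ , refl , inj₂ refl) → inj₂ (inj₁ u) , refl , u , refl , inj₂ refl })
      (λ { (_ , refl , _ , refl , inj₁ refl) → g u , refl , inj₁ refl
         ; (_ , refl , _ , refl , inj₂ refl) → g u , refl , inj₂ refl })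

    !T-lifts : ∀ U → Lifts (lift (U ∷ [])) (lift []) ⟦ !T (f U) ⟧ ⟦ !T U ⟧
    !T-lifts U a b′ = mk⇔ (λ ()) (λ { (_ , _ , ()) })

    ∇T-lifts : ∀ U → Lifts (lift (U ∷ U ∷ [])) (lift (U ∷ [])) ⟦ ∇T (f U) ⟧ ⟦ ∇T U ⟧
    ∇T-lifts U (inj₁ u) b′ = mk⇔
      (λ { (_ , refl , inj₁ refl) → inj₁ u , refl , u , refl , inj₁ refl
         ; (_ , _ , inj₂ ()) })
      (λ { (_ , refl , _ , refl , inj₁ refl) → g u , refl , inj₁ refl
         ; (_ , _ , _ , _ , inj₂ ()) })
    ∇T-lifts U (inj₂ (inj₁ u)) b′ = mk⇔
      (λ { (_ , refl , inj₂ refl) → inj₁ u , refl , u , refl , inj₂ refl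
         ; (_ , _ , inj₁ ()) })
      (λ { (_ , refl , _ , refl , inj₂ refl) → g u , refl , inj₂ refl
         ; (_ , _ , _ , _ , inj₁ ()) })

    iT-lifts : ∀ U → Lifts (lift []) (lift (U ∷ [])) ⟦ iT (f U) ⟧ ⟦ iT U ⟧
    iT-lifts U ()

    ⨾T-lifts : ∀ {P Q S} {t′ : Tape Sig (map f P) (map f Q)} {t : Tape Sig P Q}
      {s′ : Tape Sig (map f Q) (map f S)} {s : Tape Sig Q S} →
      Lifts (lift P) (lift Q) ⟦ t′ ⟧ ⟦ t ⟧ → Lifts (lift Q) (lift S) ⟦ s′ ⟧ ⟦ s ⟧ →
      Lifts (lift P) (lift S) ⟦ t′ ⨾T s′ ⟧ ⟦ t ⨾T s ⟧
    ⨾T-lifts {P} {Q} {S} {t′} {t} {s′} {s} t↑ s↑ a c′ = mk⇔ fwd bwd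
      where
      fwd : ⟦ t′ ⨾T s′ ⟧ (lift P a) c′ → ∃ λ c → c′ ≡ lift S c × ⟦ t ⨾T s ⟧ a c
      fwd (m′ , h , k) with to (t↑ a m′) h
      ... | m , refl , h′ with to (s↑ m c′) k
      ... | c , c′≡ , k′ = c , c′≡ , m , h′ , k′
      bwd : (∃ λ c → c′ ≡ lift S c × ⟦ t ⨾T s ⟧ a c) → ⟦ t′ ⨾T s′ ⟧ (lift P a) c′
      bwd (c , refl , m , h , k) =
        lift Q m , from (t↑ a (lift Q m)) (m , refl , h) , from (s↑ m (lift S c)) (c , refl , k)

    ⊕T-lifts : ∀ {P Q P′ Q′} {t′ : Tape Sig (map f P) (map f Q)} {t : Tape Sig P Q}
      {s′ : Tape Sig (map f P′) (map f Q′)} {s : Tape Sig P′ Q′} →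
      Lifts (lift P) (lift Q) ⟦ t′ ⟧ ⟦ t ⟧ → Lifts (lift P′) (lift Q′) ⟦ s′ ⟧ ⟦ s ⟧ →
      Lifts (lift (P ++ P′)) (lift (Q ++ Q′)) ⟦ t′ ⊕ᶠ s′ ⟧ ⟦ t ⊕T s ⟧
    ⊕T-lifts {P} {Q} {P′} {Q′} {t′} {t} {s′} {s} t↑ s↑ a b′ with split P P′ a
    ... | left p = mk⇔ fwd bwd
      where
      fwd : ⟦ t′ ⊕ᶠ s′ ⟧ (lift (P ++ P′) (inl I P P′ p)) b′ →
            ∃ λ b → b′ ≡ lift (Q ++ Q′) b × ⟦ t ⊕T s ⟧ (inl I P P′ p) b
      fwd h with to (⊕T-inl t′ s′ (lift P p) _)
                   (subst (λ x → ⟦ t′ ⊕T s′ ⟧ x _) (lift-inl P P′ p) (to (⟦subst₂⟧ _ _ _ _ _) h))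
      ... | q′ , e , k with to (t↑ p q′) k
      ... | q , refl , k′ =
        inl I Q Q′ q , subst-injective (map-++ f Q Q′) (trans e (sym (lift-inl Q Q′ q))) ,
        from (⊕T-inl t s p _) (q , refl , k′)
      bwd : (∃ λ b → b′ ≡ lift (Q ++ Q′) b × ⟦ t ⊕T s ⟧ (inl I P P′ p) b) →
            ⟦ t′ ⊕ᶠ s′ ⟧ (lift (P ++ P′) (inl I P P′ p)) b′
      bwd (b , refl , h) with to (⊕T-inl t s p b) h
      ... | q , refl , k =
        from (⟦subst₂⟧ _ _ _ _ _)
          (subst₂ ⟦ t′ ⊕T s′ ⟧ (sym (lift-inl P P′ p)) (sym (lift-inl Q Q′ q))
            (from (⊕T-inl t′ s′ _ _) (lift Q q , refl , from (t↑ p (lift Q q)) (q , refl , k))))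
    ... | right p = mk⇔ fwd bwd
      where
      fwd : ⟦ t′ ⊕ᶠ s′ ⟧ (lift (P ++ P′) (inr I P P′ p)) b′ →
            ∃ λ b → b′ ≡ lift (Q ++ Q′) b × ⟦ t ⊕T s ⟧ (inr I P P′ p) b
      fwd h with to (⊕T-inr t′ s′ (lift P′ p) _)
                   (subst (λ x → ⟦ t′ ⊕T s′ ⟧ x _) (lift-inr P P′ p) (to (⟦subst₂⟧ _ _ _ _ _) h))
      ... | q′ , e , k with to (s↑ p q′) k
      ... | q , refl , k′ =
        inr I Q Q′ q , subst-injective (map-++ f Q Q′) (trans e (sym (lift-inr Q Q′ q))) ,
        from (⊕T-inr t s p _) (q , refl , k′)
      bwd : (∃ λ b → b′ ≡ lift (Q ++ Q′) b × ⟦ t ⊕T s ⟧ (inr I P P′ p) b) →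
            ⟦ t′ ⊕ᶠ s′ ⟧ (lift (P ++ P′) (inr I P P′ p)) b′
      bwd (b , refl , h) with to (⊕T-inr t s p b) h
      ... | q , refl , k =
        from (⟦subst₂⟧ _ _ _ _ _)
          (subst₂ ⟦ t′ ⊕T s′ ⟧ (sym (lift-inr P P′ p)) (sym (lift-inr Q Q′ q))
            (from (⊕T-inr t′ s′ _ _) (lift Q′ q , refl , from (s↑ p (lift Q′ q)) (q , refl , k))))

  idD⊗-lifts : ∀ {W U V} (w : Pow I W) (c : Diag Sig U V) →
    Lifts (w ++ᵛ_) (w ++ᵛ_) ⟦ idD W ⊗D c ⟧ᴰ ⟦ c ⟧ᴰ
  idD⊗-lifts w c u v′ = mk⇔ fwd bwd
    where
    fwd : ⟦ idD _ ⊗D c ⟧ᴰ (w ++ᵛ u) v′ → ∃ λ v → v′ ≡ w ++ᵛ v × ⟦ c ⟧ᴰ u v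
    fwd (w₁ , u₁ , _ , v , e , refl , refl , h) with ++-injective w w₁ e
    ... | refl , refl = v , refl , h
    bwd : (∃ λ v → v′ ≡ w ++ᵛ v × ⟦ c ⟧ᴰ u v) → ⟦ idD _ ⊗D c ⟧ᴰ (w ++ᵛ u) v′
    bwd (v , refl , h) = w , u , w , v , refl , refl , refl , h

  ⊗idD-lifts : ∀ {W U V} (w : Pow I W) (c : Diag Sig U V) →
    Lifts (_++ᵛ w) (_++ᵛ w) ⟦ c ⊗D idD W ⟧ᴰ ⟦ c ⟧ᴰ
  ⊗idD-lifts w c u v′ = mk⇔ fwd bwd
    where
    fwd : ⟦ c ⊗D idD _ ⟧ᴰ (u ++ᵛ w) v′ → ∃ λ v → v′ ≡ v ++ᵛ w × ⟦ c ⟧ᴰ u v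
    fwd (u₁ , w₁ , v , _ , e , refl , h , refl) with ++-injective u u₁ e
    ... | refl , refl = v , refl , h
    bwd : (∃ λ v → v′ ≡ v ++ᵛ w × ⟦ c ⟧ᴰ u v) → ⟦ c ⊗D idD _ ⟧ᴰ (u ++ᵛ w) v′
    bwd (v , refl , h) = u , w , v , w , refl , refl , h , refl

  module _ {W : ℕ} (w : Pow I W) where
    open Lifting {W +_} (w ++ᵛ_) renaming (lift to liftˡ)

    L-lifts : ∀ {P Q} (t : Tape Sig P Q) → Lifts (liftˡ P) (liftˡ Q) ⟦ L W t ⟧ ⟦ t ⟧
    L-lifts (idT P) = idT-lifts P
    L-lifts ⌈ c ⌉ = ⌈⌉-lifts (idD W ⊗D c) c (idD⊗-lifts w c)
    L-lifts (σT U V) = σT-lifts U V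
    L-lifts (ΔT U) = ΔT-lifts U
    L-lifts (!T U) = !T-lifts U
    L-lifts (∇T U) = ∇T-lifts U
    L-lifts (iT U) = iT-lifts U
    L-lifts (t ⨾T s) = ⨾T-lifts (L-lifts t) (L-lifts s)
    L-lifts (t ⊕T s) = ⊕T-lifts (L-lifts t) (L-lifts s)

  module _ {W : ℕ} (w : Pow I W) where
    open Lifting {_+ W} (_++ᵛ w) renaming (lift to liftʳ)

    R-lifts : ∀ {P Q} (t : Tape Sig P Q) → Lifts (liftʳ P) (liftʳ Q) ⟦ R W t ⟧ ⟦ t ⟧
    R-lifts (idT P) = idT-lifts P
    R-lifts ⌈ c ⌉ = ⌈⌉-lifts (c ⊗D idD W) c (⊗idD-lifts w c)
    R-lifts (σT U V) = σT-lifts U V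
    R-lifts (ΔT U) = ΔT-lifts U
    R-lifts (!T U) = !T-lifts U
    R-lifts (∇T U) = ∇T-lifts U
    R-lifts (iT U) = iT-lifts U
    R-lifts (t ⨾T s) = ⨾T-lifts (R-lifts t) (R-lifts s)
    R-lifts (t ⊕T s) = ⊕T-lifts (R-lifts t) (R-lifts s)

  ⟦_⟧ᴬ : Tape Sig A A → Rel (X I) (X I)
  ⟦ t ⟧ᴬ x y = ⟦ t ⟧ (inj₁ (x ∷ [])) (inj₁ (y ∷ []))

  ⌈⌉-semantics : ∀ {U V} (c : Diag Sig U V) → ∀ u v → ⟦ ⌈ c ⌉ ⟧ (inj₁ u) (inj₁ v) ⇔ ⟦ c ⟧ᴰ u v
  ⌈⌉-semantics c u v = mk⇔ (λ { (_ , _ , refl , refl , h) → h }) (λ h → u , v , refl , refl , h)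

  ⊗T-semantics : ∀ {U U′ V V′} (t₁ : Tape Sig (U ∷ []) (U′ ∷ [])) (t₂ : Tape Sig (V ∷ []) (V′ ∷ [])) →
    ∀ u v u′ v′ → ⟦ t₁ ⊗T t₂ ⟧ (inj₁ (u ++ᵛ v)) (inj₁ (u′ ++ᵛ v′)) ⇔
                (⟦ t₁ ⟧ (inj₁ u) (inj₁ u′) × ⟦ t₂ ⟧ (inj₁ v) (inj₁ v′))
  ⊗T-semantics t₁ t₂ u v u′ v′ = mk⇔ fwd bwd
    where
    fwd : ⟦ t₁ ⊗T t₂ ⟧ (inj₁ (u ++ᵛ v)) (inj₁ (u′ ++ᵛ v′)) →
          ⟦ t₁ ⟧ (inj₁ u) (inj₁ u′) × ⟦ t₂ ⟧ (inj₁ v) (inj₁ v′)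
    fwd (m , h₂ , h₁) with to (L-lifts u t₂ (inj₁ v) m) h₂
    ... | inj₁ v″ , refl , h₂′ with to (R-lifts v″ t₁ (inj₁ u) _) h₁
    ... | inj₁ u″ , e , h₁′ with ++-injective u′ u″ (inj₁-injective e)
    ... | refl , refl = h₁′ , h₂′
    bwd : ⟦ t₁ ⟧ (inj₁ u) (inj₁ u′) × ⟦ t₂ ⟧ (inj₁ v) (inj₁ v′) →
          ⟦ t₁ ⊗T t₂ ⟧ (inj₁ (u ++ᵛ v)) (inj₁ (u′ ++ᵛ v′))
    bwd (h₁ , h₂) =
      inj₁ (u ++ᵛ v′) , from (L-lifts u t₂ (inj₁ v) _) (inj₁ v′ , refl , h₂) ,
      from (R-lifts v′ t₁ (inj₁ u) _) (inj₁ u′ , refl , h₁)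

  ⨾T-semantics : (t s : Tape Sig A A) → ∀ x y → ⟦ t ⨾T s ⟧ᴬ x y ⇔ ∃ λ z → ⟦ t ⟧ᴬ x z × ⟦ s ⟧ᴬ z y
  ⨾T-semantics t s x y =
    mk⇔ (λ { (inj₁ (z ∷ []) , h) → z , h }) (λ { (z , h) → inj₁ (z ∷ []) , h })

  ∪-semantics : ∀ {U} (t s : Tape Sig (U ∷ []) (U ∷ [])) → ∀ u v →
    ⟦ t ∪T s ⟧ (inj₁ u) (inj₁ v) ⇔ (⟦ t ⟧ (inj₁ u) (inj₁ v) ⊎ ⟦ s ⟧ (inj₁ u) (inj₁ v))
  ∪-semantics t s u v = mk⇔ fwd bwd
    where
    fwd : ⟦ t ∪T s ⟧ (inj₁ u) (inj₁ v) → ⟦ t ⟧ (inj₁ u) (inj₁ v) ⊎ ⟦ s ⟧ (inj₁ u) (inj₁ v)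
    fwd (_ , (_ , (_ , refl , inj₁ refl) , inj₁ (inj₁ _ , inj₁ _ , refl , refl , h)) , (_ , refl , inj₁ refl)) =
      inj₁ h
    fwd (_ , (_ , (_ , refl , inj₂ refl) , inj₂ (inj₁ _ , inj₁ _ , refl , refl , h)) , (_ , refl , inj₂ refl)) =
      inj₂ h
    fwd (_ , (_ , (_ , refl , inj₁ refl) , inj₁ (inj₁ _ , inj₁ _ , refl , refl , _)) , (_ , refl , inj₂ ()))
    fwd (_ , (_ , (_ , refl , inj₁ refl) , inj₂ (_ , _ , () , _)) , _)
    fwd (_ , (_ , (_ , refl , inj₂ refl) , inj₁ (inj₁ _ , _ , () , _)) , _)
    fwd (_ , (_ , (_ , refl , inj₂ refl) , inj₂ (inj₁ _ , inj₁ _ , refl , refl , _)) , (_ , refl , inj₁ ()))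
    bwd : ⟦ t ⟧ (inj₁ u) (inj₁ v) ⊎ ⟦ s ⟧ (inj₁ u) (inj₁ v) → ⟦ t ∪T s ⟧ (inj₁ u) (inj₁ v)
    bwd (inj₁ h) =
      inj₁ v , (inj₁ u , (u , refl , inj₁ refl) , inj₁ (inj₁ u , inj₁ v , refl , refl , h)) ,
      (v , refl , inj₁ refl)
    bwd (inj₂ h) =
      inj₂ (inj₁ v) , (inj₂ (inj₁ u) , (u , refl , inj₂ refl) , inj₂ (inj₁ u , inj₁ v , refl , refl , h)) ,
      (v , refl , inj₂ refl)

  ∩-semantics : (t s : Tape Sig A A) → ∀ x y → ⟦ t ∩T s ⟧ᴬ x y ⇔ (⟦ t ⟧ᴬ x y × ⟦ s ⟧ᴬ x y)
  ∩-semantics t s x y = mk⇔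
    (λ { (_ , (_ , (_ , _ , refl , refl , refl) , h) , (_ , _ , refl , refl , refl)) →
           to (⊗T-semantics t s (x ∷ []) (x ∷ []) (y ∷ []) (y ∷ [])) h })
    (λ h → inj₁ (y ∷ y ∷ []) ,
           (inj₁ (x ∷ x ∷ []) , (_ , _ , refl , refl , refl) ,
            from (⊗T-semantics t s (x ∷ []) (x ∷ []) (y ∷ []) (y ∷ [])) h) ,
           (_ , _ , refl , refl , refl))

  cup-semantics : ∀ x w → ⟦ cup ⟧ᴰ (x ∷ []) w ⇔ ∃ λ z → w ≡ z ∷ z ∷ x ∷ []
  cup-semantics x w = mk⇔
    (λ { ([] , _ , _ , _ , refl , refl , (z ∷ [] , _ , refl) , refl) → z , refl })
    (λ { (z , refl) → [] , x ∷ [] , z ∷ z ∷ [] , x ∷ [] , refl , refl , (z ∷ [] , tt , refl) , refl })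

  cap-semantics : ∀ a b c y → ⟦ cap ⟧ᴰ (a ∷ b ∷ c ∷ []) (y ∷ []) ⇔ (a ≡ y × b ≡ c)
  cap-semantics a b c y = mk⇔
    (λ { (_ ∷ [] , _ ∷ _ ∷ [] , _ ∷ [] , [] , refl , refl , refl , (_ ∷ [] , refl , _)) → refl , refl })
    (λ { (refl , refl) → a ∷ [] , b ∷ b ∷ [] , a ∷ [] , [] , refl , refl , refl , (b ∷ [] , refl , tt) })

  ᵒᵖ-semantics : (t : Tape Sig A A) → ∀ x y → ⟦ t ᵒᵖT ⟧ᴬ x y ⇔ ⟦ t ⟧ᴬ y x
  ᵒᵖ-semantics t x y = mk⇔ fwd bwd
    where
    fwd : ⟦ t ᵒᵖT ⟧ᴬ x y → ⟦ t ⟧ᴬ y x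
    fwd (_ , (_ , (_ , _ , refl , refl , η) , h) , (a ∷ b ∷ c ∷ [] , _ , refl , refl , ε))
      with to (cup-semantics x _) η | to (cap-semantics a b c y) ε
    ... | z , refl | refl , refl
      with to (⊗T-semantics (idT A ⊗T t) (idT A) (z ∷ z ∷ []) (x ∷ []) (y ∷ b ∷ []) (c ∷ [])) h
    ... | h′ , refl with to (⊗T-semantics (idT A) t (z ∷ []) (z ∷ []) (y ∷ []) (b ∷ [])) h′
    ... | refl , k = k
    bwd : ⟦ t ⟧ᴬ y x → ⟦ t ᵒᵖT ⟧ᴬ x y
    bwd k =
      inj₁ (y ∷ x ∷ x ∷ []) ,
      (inj₁ (y ∷ y ∷ x ∷ []) , (_ , _ , refl , refl , from (cup-semantics x _) (y , refl)) ,
       from (⊗T-semantics (idT A ⊗T t) (idT A) (y ∷ y ∷ []) (x ∷ []) (y ∷ x ∷ []) (x ∷ []))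
         (from (⊗T-semantics (idT A) t (y ∷ []) (y ∷ []) (y ∷ []) (x ∷ [])) (refl , k) , refl)) ,
      (_ , _ , refl , refl , from (cap-semantics y x x y) (refl , refl))

proposition7p7 : {Sig : Set} (E : Expr Sig) (I : RelInterp Sig) (x y : X I) →
    ⟨ E ⟩ I x y ⇔ ⟦_⟧T I (enc E) (inj₁ (x ∷ [])) (inj₁ (y ∷ []))
proposition7p7 (atom R) I x y = ⇔-sym (⌈⌉-semantics I (gen R) (x ∷ []) (y ∷ []))
proposition7p7 one I x y = mk⇔ (λ { refl → refl }) (λ { refl → refl })
proposition7p7 (E₁ ⨾ E₂) I x y =
  ⇔-trans (congˡ (proposition7p7 E₁ I x _ ×-⇔ proposition7p7 E₂ I _ y))
          (⇔-sym (⨾T-semantics I (enc E₁) (enc E₂) x y))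
proposition7p7 bot I x y = mk⇔ (λ ()) (λ { (_ , () , _) })
proposition7p7 (E₁ ∪ E₂) I x y =
  ⇔-trans (proposition7p7 E₁ I x y ⊎-⇔ proposition7p7 E₂ I x y)
          (⇔-sym (∪-semantics I (enc E₁) (enc E₂) (x ∷ []) (y ∷ [])))
proposition7p7 top I x y = mk⇔ (λ _ → _ , _ , refl , refl , [] , tt , tt) (λ _ → tt)
proposition7p7 (E₁ ∩ E₂) I x y =
  ⇔-trans (proposition7p7 E₁ I x y ×-⇔ proposition7p7 E₂ I x y)
          (⇔-sym (∩-semantics I (enc E₁) (enc E₂) x y))
proposition7p7 (E ᵒᵖ) I x y =
  ⇔-trans (proposition7p7 E I y x) (⇔-sym (ᵒᵖ-semantics I (enc E) x y))
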